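{- Let $X$ be a graph, and let $\mathcal{C}$ be a collection of cliques in $X$ such that every edge of $X$ lies in a unique clique from $\mathcal{C}$ and every vertex lies in at most $m$ cliques from $\mathcal{C}$. Then $\mu(X)\le m^2$.
   Context: $\mu(X)$ denotes the maximum number of common neighbours of a pair of vertices at distance $2$ in $X$. -}

module Defs where

open import Data.Nat using (ℕ; _≤_; _^_)
open import Data.Bool using (Bool; true; false; _∧_)
open import Data.Fin using (Fin)
open import Data.Fin.Subset using (Subset; _∈_; ∣_∣)
open import Data.Vec using (tabulate; lookup)
open import Data.Product using (Σ; _×_; ∃)
open import Relation.Binary.PropositionalEquality using (_≡_; _≢_)

record Graph (n : ℕ) : Set where
  field
    adj    : Fin n → Fin n → Bool
    sym    : ∀ u v → adj u v ≡ adj v u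
    irrefl : ∀ v → adj v v ≡ false
open Graph public

Adj : ∀ {n} → Graph n → Fin n → Fin n → Set
Adj X u v = adj X u v ≡ true

IsClique : ∀ {n} → Graph n → Subset n → Set
IsClique X S = ∀ u v → u ∈ S → v ∈ S → u ≢ v → Adj X u v

commonNbrs : ∀ {n} → Graph n → Fin n → Fin n → Subset n
commonNbrs X u v = tabulate (λ w → adj X u w ∧ adj X v w)

Dist2 : ∀ {n} → Graph n → Fin n → Fin n → Set
Dist2 X u v = u ≢ v × (adj X u v ≡ false) × ∃ (λ w → Adj X u w × Adj X w v)

-- μ(X) ≤ b : every pair at distance 2 has at most b common neighbours
μ≤ : ∀ {n} → Graph n → ℕ → Set
μ≤ X b = ∀ u v → Dist2 X u v → ∣ commonNbrs X u v ∣ ≤ b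

cliquesAt : ∀ {n k} → (Fin k → Subset n) → Fin n → Subset k
cliquesAt C v = tabulate (λ i → lookup (C i) v)

-- C is a collection of cliques in X (indexed injectively, so it is a set of
-- cliques), every edge lies in a unique clique of C, and every vertex lies in
-- at most m cliques of C.
record CliqueCover {n : ℕ} (X : Graph n) (m : ℕ) : Set where
  field
    k           : ℕ
    C           : Fin k → Subset n
    injective   : ∀ i j → C i ≡ C j → i ≡ j
    cliques     : ∀ i → IsClique X (C i)
    edgeCovered : ∀ u v → Adj X u v → Σ (Fin k) (λ i → u ∈ C i × v ∈ C i)
    edgeUnique  : ∀ u v → Adj X u v → ∀ i j →
                  u ∈ C i → v ∈ C i → u ∈ C j → v ∈ C j → i ≡ j
    atMostM     : ∀ v → ∣ cliquesAt C v ∣ ≤ m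

-- Send a common neighbour w of u and v to the pair (clique of uw, clique of wv),
-- a pair of cliques at u and at v respectively. If two common neighbours w ≠ w'
-- gave the same pair, the edge ww' would lie in both cliques, so by uniqueness
-- the two cliques coincide and contain both u and v, making u and v adjacent.
-- The map is therefore injective into a set of at most m · m pairs.
module Submission where

open import Defs hiding (sym)
open import Data.Bool using (true; false; _∧_)
open import Data.Bool.Properties using (∧-conicalˡ; ∧-conicalʳ)
open import Data.Fin using (Fin; combine; _≟_)
open import Data.Fin.Properties using (combine-injective; 0≢1+n; suc-injective)
open import Data.Fin.Subset using (Subset; _∈_; ∣_∣; inside; outside; _-_)
open import Data.Fin.Subset.Properties using (x∈p∧x≢y⇒x∈p-y; x∈p⇒∣p-x∣<∣p∣; ∣⊥∣≡0)
open import Data.Nat using (ℕ; suc; _+_; _*_; _^_; _≤_; z≤n; s≤s)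
open import Data.Nat.Properties using (≤-trans; *-mono-≤; *-identityʳ; module ≤-Reasoning)
open import Data.Product using (_×_; _,_; proj₁; proj₂)
open import Data.Vec using ([]; here; there; _∷_; _++_; map; concat; lookup)
open import Data.Vec.Properties
  using ([]=⇒lookup; lookup⇒[]=; lookup∘tabulate; lookup-concat; lookup-map; map-id; map-const)
open import Relation.Nullary.Decidable using (decidable-stable)
open import Relation.Binary.PropositionalEquality
  using (_≡_; _≢_; refl; sym; trans; cong; cong₂; subst; module ≡-Reasoning)

private
  variable
    n n₁ n₂ : ℕ

lookup≡true⇒∈ : {p : Subset n} {x : Fin n} → lookup p x ≡ true → x ∈ p
lookup≡true⇒∈ {p = p} {x} = lookup⇒[]= x p

∣p++q∣≡∣p∣+∣q∣ : (p : Subset n₁) (q : Subset n₂) → ∣ p ++ q ∣ ≡ ∣ p ∣ + ∣ q ∣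
∣p++q∣≡∣p∣+∣q∣ []            q = refl
∣p++q∣≡∣p∣+∣q∣ (outside ∷ p) q = ∣p++q∣≡∣p∣+∣q∣ p q
∣p++q∣≡∣p∣+∣q∣ (inside ∷ p)  q = cong suc (∣p++q∣≡∣p∣+∣q∣ p q)

-- Product of subsets, indexed along the bijection combine : Fin n₁ × Fin n₂ → Fin (n₁ * n₂).
_⊗_ : Subset n₁ → Subset n₂ → Subset (n₁ * n₂)
p ⊗ q = concat (map (λ x → map (x ∧_) q) p)

combine∈⊗ : {p : Subset n₁} {q : Subset n₂} {i : Fin n₁} {j : Fin n₂} →
            i ∈ p → j ∈ q → combine i j ∈ p ⊗ q
combine∈⊗ {p = p} {q} {i} {j} i∈p j∈q = lookup≡true⇒∈ (begin
  lookup (p ⊗ q) (combine i j)                     ≡⟨ lookup-concat (map (λ x → map (x ∧_) q) p) i j ⟩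
  lookup (lookup (map (λ x → map (x ∧_) q) p) i) j ≡⟨ cong (λ r → lookup r j) (lookup-map i _ p) ⟩
  lookup (map (lookup p i ∧_) q) j                 ≡⟨ lookup-map j _ q ⟩
  lookup p i ∧ lookup q j                          ≡⟨ cong₂ _∧_ ([]=⇒lookup i∈p) ([]=⇒lookup j∈q) ⟩
  true                                             ∎)
  where open ≡-Reasoning

∣p⊗q∣≡∣p∣*∣q∣ : (p : Subset n₁) (q : Subset n₂) → ∣ p ⊗ q ∣ ≡ ∣ p ∣ * ∣ q ∣
∣p⊗q∣≡∣p∣*∣q∣ []            q = refl
∣p⊗q∣≡∣p∣*∣q∣ {n₂ = n₂} (outside ∷ p) q = begin
  ∣ map (false ∧_) q ++ p ⊗ q ∣    ≡⟨ ∣p++q∣≡∣p∣+∣q∣ (map (false ∧_) q) (p ⊗ q) ⟩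
  ∣ map (false ∧_) q ∣ + ∣ p ⊗ q ∣ ≡⟨ cong₂ _+_ (trans (cong ∣_∣ (map-const q false)) (∣⊥∣≡0 n₂))
                                               (∣p⊗q∣≡∣p∣*∣q∣ p q) ⟩
  ∣ p ∣ * ∣ q ∣                    ∎
  where open ≡-Reasoning
∣p⊗q∣≡∣p∣*∣q∣ (inside ∷ p)  q = begin
  ∣ map (true ∧_) q ++ p ⊗ q ∣    ≡⟨ ∣p++q∣≡∣p∣+∣q∣ (map (true ∧_) q) (p ⊗ q) ⟩
  ∣ map (true ∧_) q ∣ + ∣ p ⊗ q ∣ ≡⟨ cong₂ _+_ (cong ∣_∣ (map-id q)) (∣p⊗q∣≡∣p∣*∣q∣ p q) ⟩
  ∣ q ∣ + ∣ p ∣ * ∣ q ∣           ∎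
  where open ≡-Reasoning

injection⇒∣p∣≤∣q∣ : (p : Subset n) (q : Subset n₁) (f : ∀ {x} → x ∈ p → Fin n₁) →
                    (∀ {x} (x∈p : x ∈ p) → f x∈p ∈ q) →
                    (∀ {x y} (x∈p : x ∈ p) (y∈p : y ∈ p) → f x∈p ≡ f y∈p → x ≡ y) →
                    ∣ p ∣ ≤ ∣ q ∣
injection⇒∣p∣≤∣q∣ []            q f f∈q f-inj = z≤n
injection⇒∣p∣≤∣q∣ (outside ∷ p) q f f∈q f-inj =
  injection⇒∣p∣≤∣q∣ p q (λ x∈p → f (there x∈p)) (λ x∈p → f∈q (there x∈p))
    (λ x∈p y∈p eq → suc-injective (f-inj (there x∈p) (there y∈p) eq))
injection⇒∣p∣≤∣q∣ (inside ∷ p)  q f f∈q f-inj =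
  ≤-trans (s≤s (injection⇒∣p∣≤∣q∣ p (q - f here) (λ x∈p → f (there x∈p)) f∈q-f-here
                 (λ x∈p y∈p eq → suc-injective (f-inj (there x∈p) (there y∈p) eq))))
          (x∈p⇒∣p-x∣<∣p∣ (f∈q here))
  where
  f∈q-f-here : ∀ {x} (x∈p : x ∈ p) → f (there x∈p) ∈ q - f here
  f∈q-f-here x∈p = x∈p∧x≢y⇒x∈p-y (f∈q (there x∈p)) (λ eq → 0≢1+n (f-inj here (there x∈p) (sym eq)))

commonNbr⇒adj : (X : Graph n) {u v w : Fin n} → w ∈ commonNbrs X u v → Adj X u w × Adj X w v
commonNbr⇒adj X {u} {v} {w} w∈ =
  ∧-conicalˡ _ _ uw∧vw , trans (Graph.sym X w v) (∧-conicalʳ _ _ uw∧vw)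
  where
  uw∧vw : adj X u w ∧ adj X v w ≡ true
  uw∧vw = trans (sym (lookup∘tabulate _ w)) ([]=⇒lookup w∈)

module _ {X : Graph n} {m : ℕ} (cov : CliqueCover X m) where
  open CliqueCover cov

  cliqueOf : {u v : Fin n} → Adj X u v → Fin k
  cliqueOf {u} {v} u~v = proj₁ (edgeCovered u v u~v)

  ∈cliqueOfˡ : {u v : Fin n} (u~v : Adj X u v) → u ∈ C (cliqueOf u~v)
  ∈cliqueOfˡ {u} {v} u~v = proj₁ (proj₂ (edgeCovered u v u~v))

  ∈cliqueOfʳ : {u v : Fin n} (u~v : Adj X u v) → v ∈ C (cliqueOf u~v)
  ∈cliqueOfʳ {u} {v} u~v = proj₂ (proj₂ (edgeCovered u v u~v))

  ∈cliquesAt : {u : Fin n} {i : Fin k} → u ∈ C i → i ∈ cliquesAt C u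
  ∈cliquesAt {u} {i} u∈Cᵢ = lookup≡true⇒∈ (trans (lookup∘tabulate _ i) ([]=⇒lookup u∈Cᵢ))

  sharedEdge⇒≡ : {w w' : Fin n} {i j : Fin k} → w ≢ w' →
                 w ∈ C i → w' ∈ C i → w ∈ C j → w' ∈ C j → i ≡ j
  sharedEdge⇒≡ {w} {w'} {i} {j} w≢w' w∈Cᵢ w'∈Cᵢ w∈Cⱼ w'∈Cⱼ =
    edgeUnique w w' (cliques i w w' w∈Cᵢ w'∈Cᵢ w≢w') i j w∈Cᵢ w'∈Cᵢ w∈Cⱼ w'∈Cⱼ

  cliquePair : {u v w : Fin n} → w ∈ commonNbrs X u v → Fin (k * k)
  cliquePair w∈ = combine (cliqueOf (proj₁ (commonNbr⇒adj X w∈)))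
                          (cliqueOf (proj₂ (commonNbr⇒adj X w∈)))

  cliquePair∈ : {u v w : Fin n} (w∈ : w ∈ commonNbrs X u v) →
                cliquePair w∈ ∈ cliquesAt C u ⊗ cliquesAt C v
  cliquePair∈ w∈ = combine∈⊗ (∈cliquesAt (∈cliqueOfˡ (proj₁ (commonNbr⇒adj X w∈))))
                             (∈cliquesAt (∈cliqueOfʳ (proj₂ (commonNbr⇒adj X w∈))))

  cliquePair-injective : {u v w w' : Fin n} → u ≢ v → adj X u v ≡ false →
                         (w∈ : w ∈ commonNbrs X u v) (w'∈ : w' ∈ commonNbrs X u v) →
                         cliquePair w∈ ≡ cliquePair w'∈ → w ≡ w'
  cliquePair-injective {u} {v} {w} {w'} u≢v u≁v w∈ w'∈ eq = decidable-stable (w ≟ w') λ w≢w' →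
    let u~w , w~v = commonNbr⇒adj X w∈
        u~w' , w'~v = commonNbr⇒adj X w'∈
        i≡i' , j≡j' = combine-injective _ _ _ _ eq
        i = cliqueOf u~w
        i≡j = sharedEdge⇒≡ w≢w' (∈cliqueOfʳ u~w) (subst (λ t → w' ∈ C t) (sym i≡i') (∈cliqueOfʳ u~w'))
                                (∈cliqueOfˡ w~v) (subst (λ t → w' ∈ C t) (sym j≡j') (∈cliqueOfˡ w'~v))
        u~v = cliques i u v (∈cliqueOfˡ u~w) (subst (λ t → v ∈ C t) (sym i≡j) (∈cliqueOfʳ w~v)) u≢v
    in true≢false (trans (sym u~v) u≁v)
    where
    true≢false : true ≢ false
    true≢false ()

lemma2p34 : ∀ {n} (X : Graph n) (m : ℕ) → CliqueCover X m → μ≤ X (m ^ 2)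
lemma2p34 X m cov u v (u≢v , u≁v , _) = begin
  ∣ commonNbrs X u v ∣                  ≤⟨ injection⇒∣p∣≤∣q∣ _ _ (cliquePair cov) (cliquePair∈ cov)
                                                              (cliquePair-injective cov u≢v u≁v) ⟩
  ∣ cliquesAt C u ⊗ cliquesAt C v ∣     ≡⟨ ∣p⊗q∣≡∣p∣*∣q∣ (cliquesAt C u) (cliquesAt C v) ⟩
  ∣ cliquesAt C u ∣ * ∣ cliquesAt C v ∣ ≤⟨ *-mono-≤ (atMostM u) (atMostM v) ⟩
  m * m                                 ≡⟨ cong (m *_) (sym (*-identityʳ m)) ⟩
  m ^ 2                                 ∎
  where
  open CliqueCover cov
  open ≤-Reasoning
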